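{- Let $G$ be a finite group, $\Gamma_G$ its power graph and $M_G$ the set of maximal involutions of $G$. If $|M_G|=2$, then $\mathrm{rc}(\Gamma_G)=3$.
   Context: For a finite group $G$ with identity $e$, the power graph $\Gamma_G$ is the undirected graph with vertex set $G$ in which two distinct elements are adjacent if one is a power of the other. An involution is an element of order $2$. An involution $x$ is maximal if the only cyclic subgroup of $G$ containing $x$ is $\langle x\rangle$; $M_G$ denotes the set of maximal involutions of $G$. For a connected graph $\Gamma$, an edge coloring $\zeta:E(\Gamma)\to\{1,\dots,k\}$ (adjacent edges may receive the same color) is a rainbow $k$-coloring if every pair of vertices is joined by a path whose edges have pairwise distinct colors; the rainbow connection number $\mathrm{rc}(\Gamma)$ is the minimum $k$ for which a rainbow $k$-coloring exists. -}

module Defs where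

open import Data.Nat using (ℕ; zero; suc; _<_)
open import Data.Fin using (Fin)
open import Data.List using (List; []; _∷_; map)
open import Data.List.Relation.Unary.All using (All)
open import Data.List.Relation.Unary.Unique.Propositional using (Unique)
open import Data.Product using (Σ; _×_; _,_; ∃; ∃-syntax; uncurry)
open import Data.Sum using (_⊎_)
open import Relation.Nullary using (¬_)
open import Relation.Binary.PropositionalEquality using (_≡_; _≢_)
open import Algebra.Structures using (IsGroup)

-- Finite groups: a group structure (with propositional equality) on Fin n.
-- Every finite group is isomorphic to one of these.

record FiniteGroup : Set where
  field
    order   : ℕ
    _∙_     : Fin order → Fin order → Fin order
    e       : Fin order
    _⁻¹     : Fin order → Fin order
    isGroup : IsGroup _≡_ _∙_ e _⁻¹

  Elt : Set
  Elt = Fin order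

  _^_ : Elt → ℕ → Elt
  x ^ zero  = e
  x ^ suc k = x ∙ (x ^ k)

  -- z belongs to the cyclic subgroup ⟨ y ⟩ (G finite, so natural powers suffice)
  _∈⟨_⟩ : Elt → Elt → Set
  z ∈⟨ y ⟩ = ∃[ k ] (y ^ k ≡ z)

  PowerAdj : Elt → Elt → Set
  PowerAdj x y = x ≢ y × ((∃[ k ] (y ≡ x ^ k)) ⊎ (∃[ k ] (x ≡ y ^ k)))

  Involution : Elt → Set
  Involution x = x ≢ e × x ∙ x ≡ e

  MaximalInvolution : Elt → Set
  MaximalInvolution x =
    Involution x ×
    (∀ y → x ∈⟨ y ⟩ → (∀ z → z ∈⟨ y ⟩ → z ∈⟨ x ⟩) × (∀ z → z ∈⟨ x ⟩ → z ∈⟨ y ⟩))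

  TwoMaximalInvolutions : Set
  TwoMaximalInvolutions =
    Σ Elt λ a → Σ Elt λ b →
      a ≢ b × MaximalInvolution a × MaximalInvolution b ×
      (∀ c → MaximalInvolution c → c ≡ a ⊎ c ≡ b)

module _ {n : ℕ} (Adj : Fin n → Fin n → Set) where

  -- An edge colouring with colours Fin k (i.e. {1,…,k}): a colour for every
  -- unordered pair; only the values on edges matter.
  record EdgeColouring (k : ℕ) : Set where
    field
      col  : Fin n → Fin n → Fin k
      symm : ∀ x y → col x y ≡ col y x

  steps : Fin n → List (Fin n) → List (Fin n × Fin n)
  steps x []       = []
  steps x (v ∷ vs) = (x , v) ∷ steps v vs

  endpoint : Fin n → List (Fin n) → Fin n
  endpoint x []       = x
  endpoint x (v ∷ vs) = endpoint v vs

  RainbowPath : ∀ {k} → EdgeColouring k → Fin n → Fin n → List (Fin n) → Set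
  RainbowPath c x y vs =
    endpoint x vs ≡ y ×
    All (uncurry Adj) (steps x vs) ×
    Unique (x ∷ vs) ×
    Unique (map (uncurry (EdgeColouring.col c)) (steps x vs))

  IsRainbowColouring : ∀ {k} → EdgeColouring k → Set
  IsRainbowColouring c = ∀ x y → ∃[ vs ] RainbowPath c x y vs

  HasRainbowColouring : ℕ → Set
  HasRainbowColouring k = Σ (EdgeColouring k) IsRainbowColouring

  RainbowConnectionNumber : ℕ → Set
  RainbowConnectionNumber k =
    HasRainbowColouring k × (∀ j → j < k → ¬ HasRainbowColouring j)

powerGraphRC : (G : FiniteGroup) → ℕ → Set
powerGraphRC G = RainbowConnectionNumber (FiniteGroup.PowerAdj G)

-- A maximal involution is adjacent only to
-- e in the power graph, so a and b are pendant vertices hanging at e.  A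
-- rainbow path leaving a pendant vertex either is p–e–y with two different
-- colours or already shows three colours.  Taking y = b, and y = ab from both
-- a and b, forces col(a,e), col(b,e), col(e,ab) to be pairwise distinct.
--
-- Every involution other than a, b lies in
-- the cyclic group of a non-involution w (a "root"), since otherwise it would
-- be maximal.  Vertices get colours: a ↦ 0, b ↦ 1, the other involutions ↦ 2,
-- and each pair {w, w⁻¹} of non-involutions gets {0, 1}.  The edge e–y has
-- the colour of y, the edge w–w⁻¹ has colour 2, an edge from an involution to
-- a non-involution w has the colour of w⁻¹.  Any x, y are then joined by one
-- of the rainbow paths x–e–y, x–e–y⁻¹–y, x–x⁻¹–e–y or x–w–e–y.
module Submission where

open import Defs
open import Algebra.Bundles using (Group)
import Algebra.Properties.Group as GroupProperties
open import Algebra.Structures using (IsGroup)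
open import Data.Empty using (⊥-elim)
open import Data.Fin using (Fin; zero; suc; toℕ; fromℕ<)
open import Data.Fin.Properties using (_≟_; any?; pigeonhole; toℕ-fromℕ<; toℕ<n; toℕ-injective)
open import Data.List using ([]; _∷_)
open import Data.List.Relation.Unary.All using ([]; _∷_)
open import Data.List.Relation.Unary.AllPairs using ([]; _∷_)
open import Data.Nat using (ℕ; zero; suc; _+_; _*_; _≤_; _<_; _<?_; z≤n; s≤s)
open import Data.Nat.DivMod using (_%_; _/_; m≡m%n+[m/n]*n; m%n<n)
open import Data.Nat.Properties using (n<1+n; <⇒≱; <-asym; ≮⇒≥; ≤-antisym; ≤-trans; <-≤-trans; m≤m+n; +-comm; ≤-pred; m≤n⇒∃[o]m+o≡n)
open import Data.Product using (_×_; _,_; ∃; ∃-syntax; proj₁)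
open import Data.Sum using (_⊎_; inj₁; inj₂; [_,_])
open import Function using (id)
open import Level using (0ℓ)
open import Relation.Nullary using (¬_; Dec; yes; no)
open import Relation.Nullary.Decidable using (_×-dec_; ¬?; map′)
open import Relation.Binary.PropositionalEquality using (_≡_; _≢_; refl; sym; trans; cong; cong₂; subst; ≢-sym; module ≡-Reasoning)

three≤ : ∀ {k} (u v w : Fin k) → u ≢ v → u ≢ w → v ≢ w → 3 ≤ k
three≤ {0} () _ _ _ _ _
three≤ {1} zero zero _ u≢v _ _ = ⊥-elim (u≢v refl)
three≤ {2} zero zero _ u≢v _ _ = ⊥-elim (u≢v refl)
three≤ {2} (suc zero) (suc zero) _ u≢v _ _ = ⊥-elim (u≢v refl)
three≤ {2} zero (suc zero) zero _ u≢w _ = ⊥-elim (u≢w refl)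
three≤ {2} zero (suc zero) (suc zero) _ _ v≢w = ⊥-elim (v≢w refl)
three≤ {2} (suc zero) zero zero _ _ v≢w = ⊥-elim (v≢w refl)
three≤ {2} (suc zero) zero (suc zero) _ u≢w _ = ⊥-elim (u≢w refl)
three≤ {suc (suc (suc _))} _ _ _ _ _ _ = s≤s (s≤s (s≤s z≤n))

Pendant : ∀ {n} → (Fin n → Fin n → Set) → Fin n → Fin n → Set
Pendant Adj p c = ∀ v → Adj p v → v ≡ c

module RainbowPaths {n : ℕ} {Adj : Fin n → Fin n → Set} {k : ℕ} (C : EdgeColouring Adj k) where
  open EdgeColouring C using (col; symm)

  rainbowPath₀ : ∀ x → RainbowPath Adj C x x []
  rainbowPath₀ x = refl , [] , [] ∷ [] , []

  rainbowPath₁ : ∀ {x y} → Adj x y → x ≢ y → RainbowPath Adj C x y (y ∷ [])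
  rainbowPath₁ xy x≢y = refl , xy ∷ [] , (x≢y ∷ []) ∷ [] ∷ [] , [] ∷ []

  rainbowPath₂ : ∀ {x y z} → Adj x y → Adj y z →
                 x ≢ y → x ≢ z → y ≢ z →
                 col x y ≢ col y z → RainbowPath Adj C x z (y ∷ z ∷ [])
  rainbowPath₂ xy yz x≢y x≢z y≢z c≢ =
    refl , xy ∷ yz ∷ [] , (x≢y ∷ x≢z ∷ []) ∷ (y≢z ∷ []) ∷ [] ∷ [] , (c≢ ∷ []) ∷ [] ∷ []

  rainbowPath₃ : ∀ {x y z w} → Adj x y → Adj y z → Adj z w →
                 x ≢ y → x ≢ z → x ≢ w → y ≢ z → y ≢ w → z ≢ w →
                 col x y ≢ col y z → col x y ≢ col z w → col y z ≢ col z w →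
                 RainbowPath Adj C x w (y ∷ z ∷ w ∷ [])
  rainbowPath₃ xy yz zw x≢y x≢z x≢w y≢z y≢w z≢w c₁≢c₂ c₁≢c₃ c₂≢c₃ =
    refl , xy ∷ yz ∷ zw ∷ [] ,
    (x≢y ∷ x≢z ∷ x≢w ∷ []) ∷ (y≢z ∷ y≢w ∷ []) ∷ (z≢w ∷ []) ∷ [] ∷ [] ,
    (c₁≢c₂ ∷ c₁≢c₃ ∷ []) ∷ (c₂≢c₃ ∷ []) ∷ [] ∷ []

  -- A rainbow path from a pendant vertex p (at c) to y ∉ {p, c} must pass
  -- p–c–y; it either stops at y, with two distinct colours, or continues
  -- and then already shows three distinct colours.
  pendantPath : ∀ {p c y} → Pendant Adj p c → y ≢ p → y ≢ c →
                ∃[ vs ] RainbowPath Adj C p y vs → 3 ≤ k ⊎ col p c ≢ col c y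
  pendantPath _ y≢p _ ([] , p≡y , _) = ⊥-elim (y≢p (sym p≡y))
  pendantPath pendant y≢p y≢c (v ∷ vs , path@(_ , pv ∷ _ , _)) with pendant v pv
  pendantPath _ _ y≢c (_ ∷ [] , c≡y , _) | refl = ⊥-elim (y≢c (sym c≡y))
  pendantPath _ _ _ (_ ∷ _ ∷ [] , refl , _ , _ , (c₁≢c₂ ∷ []) ∷ _) | refl = inj₂ c₁≢c₂
  pendantPath _ _ _ (_ ∷ _ ∷ _ ∷ _ , _ , _ , _ , (c₁≢c₂ ∷ c₁≢c₃ ∷ _) ∷ (c₂≢c₃ ∷ _) ∷ _) | refl =
    inj₁ (three≤ _ _ _ c₁≢c₂ c₁≢c₃ c₂≢c₃)

  -- Two pendant vertices a ≠ b at a common c, plus a fourth vertex x, force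
  -- at least three colours: col(a,c), col(c,b), col(c,x) are pairwise distinct.
  twoPendants⇒3≤ : ∀ {a b c x} → Pendant Adj a c → Pendant Adj b c →
                   b ≢ a → b ≢ c → x ≢ a → x ≢ b → x ≢ c →
                   IsRainbowColouring Adj C → 3 ≤ k
  twoPendants⇒3≤ {a} {b} {c} {x} pa pb b≢a b≢c x≢a x≢b x≢c rainbow
    with pendantPath pa b≢a b≢c (rainbow a b)
       | pendantPath pa x≢a x≢c (rainbow a x)
       | pendantPath pb x≢b x≢c (rainbow b x)
  ... | inj₁ 3≤k | _ | _ = 3≤k
  ... | _ | inj₁ 3≤k | _ = 3≤k
  ... | _ | _ | inj₁ 3≤k = 3≤k
  ... | inj₂ ac≢cb | inj₂ ac≢cx | inj₂ bc≢cx =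
    three≤ (col a c) (col c b) (col c x) ac≢cb ac≢cx (λ eq → bc≢cx (trans (symm b c) eq))

c₀ c₁ c₂ : Fin 3
c₀ = zero
c₁ = suc zero
c₂ = suc (suc zero)

opposite : Fin 3 → Fin 3
opposite zero = c₁
opposite (suc zero) = c₀
opposite (suc (suc zero)) = c₂

opposite-moves : ∀ {u} → u ≢ c₂ → opposite u ≢ u
opposite-moves {zero} _ ()
opposite-moves {suc zero} _ ()
opposite-moves {suc (suc zero)} u≢c₂ _ = u≢c₂ refl

opposite-avoids-c₂ : ∀ {u} → u ≢ c₂ → opposite u ≢ c₂
opposite-avoids-c₂ {zero} _ ()
opposite-avoids-c₂ {suc zero} _ ()
opposite-avoids-c₂ {suc (suc zero)} u≢c₂ _ = u≢c₂ refl

≢-resp : ∀ {A : Set} {c d u v : A} → c ≡ u → d ≡ v → u ≢ v → c ≢ d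
≢-resp refl refl u≢v = u≢v

data Kind : Set where
  identity involution generic : Kind

edgeTable : Kind → Kind → Fin 3 → Fin 3 → Fin 3
edgeTable identity   identity   _  _  = c₂
edgeTable identity   _          _  cy = cy
edgeTable _          identity   cx _  = cx
edgeTable involution generic    _  cy = opposite cy
edgeTable generic    involution cx _  = opposite cx
edgeTable _          _          _  _  = c₂

edgeTable-symm : ∀ k l cx cy → edgeTable k l cx cy ≡ edgeTable l k cy cx
edgeTable-symm identity   identity   _ _ = refl
edgeTable-symm identity   involution _ _ = refl
edgeTable-symm identity   generic    _ _ = refl
edgeTable-symm involution identity   _ _ = refl
edgeTable-symm involution involution _ _ = refl
edgeTable-symm involution generic    _ _ = refl
edgeTable-symm generic    identity   _ _ = refl
edgeTable-symm generic    involution _ _ = refl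
edgeTable-symm generic    generic    _ _ = refl

module PowerGraph (G : FiniteGroup) where
  open FiniteGroup G
  open IsGroup isGroup using (assoc; identityˡ; identityʳ; inverseʳ)

  group : Group 0ℓ 0ℓ
  group = record { Carrier = Elt ; _≈_ = _≡_ ; _∙_ = _∙_ ; ε = e ; _⁻¹ = _⁻¹ ; isGroup = isGroup }

  open GroupProperties group using (∙-cancelˡ; ∙-cancelʳ; inverseʳ-unique; ⁻¹-involutive)

  square≡e⇒self-inverse : ∀ {x} → x ∙ x ≡ e → x ≡ x ⁻¹
  square≡e⇒self-inverse {x} xx≡e = inverseʳ-unique x x xx≡e

  self-inverse⇒square≡e : ∀ {x} → x ≡ x ⁻¹ → x ∙ x ≡ e
  self-inverse⇒square≡e {x} x≡x⁻¹ = trans (cong (x ∙_) x≡x⁻¹) (inverseʳ x)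

  inverse-square≢e : ∀ {x} → x ∙ x ≢ e → (x ⁻¹) ∙ (x ⁻¹) ≢ e
  inverse-square≢e {x} xx≢e x⁻¹x⁻¹≡e =
    xx≢e (self-inverse⇒square≡e (trans (sym (⁻¹-involutive x)) (sym (square≡e⇒self-inverse x⁻¹x⁻¹≡e))))

  square≢e⇒≢e : ∀ {x} → x ∙ x ≢ e → x ≢ e
  square≢e⇒≢e xx≢e refl = xx≢e (identityˡ e)

  square≢e⇒≢inverse : ∀ {x} → x ∙ x ≢ e → x ≢ x ⁻¹
  square≢e⇒≢inverse xx≢e x≡x⁻¹ = xx≢e (self-inverse⇒square≡e x≡x⁻¹)

  square≡e⇒≢square≢e : ∀ {x w} → x ∙ x ≡ e → w ∙ w ≢ e → x ≢ w
  square≡e⇒≢square≢e xx≡e ww≢e refl = ww≢e xx≡e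

  ^-+ : ∀ x m n → x ^ (m + n) ≡ (x ^ m) ∙ (x ^ n)
  ^-+ x zero n = sym (identityˡ _)
  ^-+ x (suc m) n = trans (cong (x ∙_) (^-+ x m n)) (sym (assoc x _ _))

  ^-multiple : ∀ {y p} → y ^ p ≡ e → ∀ q → y ^ (q * p) ≡ e
  ^-multiple yᵖ≡e zero = refl
  ^-multiple {y} {p} yᵖ≡e (suc q) = begin
    y ^ (p + q * p)       ≡⟨ ^-+ y p (q * p) ⟩
    (y ^ p) ∙ (y ^ (q * p))   ≡⟨ cong₂ _∙_ yᵖ≡e (^-multiple yᵖ≡e q) ⟩
    e ∙ e                 ≡⟨ identityˡ e ⟩
    e                     ∎
    where open ≡-Reasoning

  -- Every y has a period 1 ≤ p ≤ |G|: two of y⁰, …, y^|G| coincide.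
  period : ∀ y → ∃[ q ] (suc q ≤ order × y ^ suc q ≡ e)
  period y with pigeonhole (n<1+n order) (λ i → y ^ toℕ i)
  ... | i , j , i<j , yⁱ≡yʲ with m≤n⇒∃[o]m+o≡n i<j
  ... | q , i+1+q≡j = q , bound , ∙-cancelʳ (y ^ toℕ i) (y ^ suc q) e shifted
    where
      q+1+i≡j : suc q + toℕ i ≡ toℕ j
      q+1+i≡j = trans (cong suc (+-comm q (toℕ i))) i+1+q≡j
      bound : suc q ≤ order
      bound = ≤-trans (m≤m+n (suc q) (toℕ i)) (≤-pred (subst (_< suc order) (sym q+1+i≡j) (toℕ<n j)))
      shifted : (y ^ suc q) ∙ (y ^ toℕ i) ≡ e ∙ (y ^ toℕ i)
      shifted = begin
        (y ^ suc q) ∙ (y ^ toℕ i)   ≡⟨ ^-+ y (suc q) (toℕ i) ⟨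
        y ^ (suc q + toℕ i)     ≡⟨ cong (y ^_) q+1+i≡j ⟩
        y ^ toℕ j               ≡⟨ yⁱ≡yʲ ⟨
        y ^ toℕ i               ≡⟨ identityˡ _ ⟨
        e ∙ (y ^ toℕ i)           ∎
        where open ≡-Reasoning

  -- Every power of y is a power with exponent below |G|: reduce modulo a period.
  smallExponent : ∀ y k → ∃ λ (r : Fin order) → y ^ toℕ r ≡ y ^ k
  smallExponent y k with period y
  ... | q , p≤order , yᵖ≡e = fromℕ< r<order , reduced
    where
      p = suc q
      r<order : k % p < order
      r<order = <-≤-trans (m%n<n k p) p≤order
      reduced : y ^ toℕ (fromℕ< r<order) ≡ y ^ k
      reduced = begin
        y ^ toℕ (fromℕ< r<order)      ≡⟨ cong (y ^_) (toℕ-fromℕ< r<order) ⟩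
        y ^ (k % p)                   ≡⟨ identityʳ _ ⟨
        (y ^ (k % p)) ∙ e             ≡⟨ cong ((y ^ (k % p)) ∙_) (^-multiple yᵖ≡e (k / p)) ⟨
        (y ^ (k % p)) ∙ (y ^ ((k / p) * p)) ≡⟨ ^-+ y (k % p) ((k / p) * p) ⟨
        y ^ (k % p + (k / p) * p)     ≡⟨ cong (y ^_) (m≡m%n+[m/n]*n k p) ⟨
        y ^ k                         ∎
        where open ≡-Reasoning

  -- The inverse of y is a power of y (y · y^(p-1) = e for a period p).
  inverse-power : ∀ y → y ⁻¹ ∈⟨ y ⟩
  inverse-power y with period y
  ... | q , _ , yᵖ≡e = q , inverseʳ-unique y (y ^ q) yᵖ≡e

  cyclic-of-involution : ∀ {x z} → x ∙ x ≡ e → z ∈⟨ x ⟩ → z ≡ e ⊎ z ≡ x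
  cyclic-of-involution xx≡e (zero , refl) = inj₁ refl
  cyclic-of-involution {x} xx≡e (suc k , refl) with cyclic-of-involution xx≡e (k , refl)
  ... | inj₁ xᵏ≡e = inj₂ (trans (cong (x ∙_) xᵏ≡e) (identityʳ x))
  ... | inj₂ xᵏ≡x = inj₁ (trans (cong (x ∙_) xᵏ≡x) xx≡e)

  -- A root of x: a non-involution w with x ∈ ⟨w⟩.  Rootedness is decidable,
  -- since exponents may be taken below |G|.
  Root : Elt → Set
  Root x = ∃[ w ] (w ∙ w ≢ e × x ∈⟨ w ⟩)

  root? : ∀ x → Dec (Root x)
  root? x = map′ fromBounded toBounded
    (any? λ w → any? λ r → ¬? ((w ∙ w) ≟ e) ×-dec ((w ^ toℕ r) ≟ x))
    where
      fromBounded : (∃ λ w → ∃ λ r → w ∙ w ≢ e × w ^ toℕ r ≡ x) → Root x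
      fromBounded (w , r , ww≢e , wʳ≡x) = w , ww≢e , toℕ r , wʳ≡x
      toBounded : Root x → ∃ λ w → ∃ λ r → w ∙ w ≢ e × w ^ toℕ r ≡ x
      toBounded (w , ww≢e , k , wᵏ≡x) with smallExponent w k
      ... | r , wʳ≡wᵏ = w , r , ww≢e , trans wʳ≡wᵏ wᵏ≡x

  -- An involution without a root is maximal: a generator y of a cyclic group
  -- containing x is itself an involution, hence y = x.
  rootless⇒maximal : ∀ {x} → Involution x → ¬ Root x → MaximalInvolution x
  rootless⇒maximal {x} inv@(x≢e , _) rootless = inv , λ y x∈⟨y⟩ → sameCyclic (generator≡x y x∈⟨y⟩)
    where
      generator≡x : ∀ y → x ∈⟨ y ⟩ → y ≡ x
      generator≡x y (k , yᵏ≡x) with (y ∙ y) ≟ e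
      ... | no yy≢e = ⊥-elim (rootless (y , yy≢e , k , yᵏ≡x))
      ... | yes yy≡e with cyclic-of-involution yy≡e (k , refl)
      ...   | inj₁ yᵏ≡e = ⊥-elim (x≢e (trans (sym yᵏ≡x) yᵏ≡e))
      ...   | inj₂ yᵏ≡y = trans (sym yᵏ≡y) yᵏ≡x
      sameCyclic : ∀ {y} → y ≡ x → (∀ z → z ∈⟨ y ⟩ → z ∈⟨ x ⟩) × (∀ z → z ∈⟨ x ⟩ → z ∈⟨ y ⟩)
      sameCyclic refl = (λ _ z∈ → z∈) , (λ _ z∈ → z∈)

  maximal-or-rooted : ∀ {x} → Involution x → MaximalInvolution x ⊎ Root x
  maximal-or-rooted {x} inv with root? x
  ... | yes root = inj₂ root
  ... | no rootless = inj₁ (rootless⇒maximal inv rootless)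

  -- A maximal involution x is adjacent only to e: every neighbour v lies in
  -- ⟨x⟩ = {e, x} (directly, or by maximality when x ∈ ⟨v⟩).
  maximal⇒pendant : ∀ {x} → MaximalInvolution x → Pendant PowerAdj x e
  maximal⇒pendant {x} ((_ , xx≡e) , maximal) v (x≢v , power) =
    [ id , (λ v≡x → ⊥-elim (x≢v (sym v≡x))) ] (cyclic-of-involution xx≡e (neighbour∈⟨x⟩ power))
    where
      neighbour∈⟨x⟩ : (∃[ k ] (v ≡ x ^ k)) ⊎ (∃[ k ] (x ≡ v ^ k)) → v ∈⟨ x ⟩
      neighbour∈⟨x⟩ (inj₁ (k , v≡xᵏ)) = k , sym v≡xᵏ
      neighbour∈⟨x⟩ (inj₂ (k , x≡vᵏ)) = proj₁ (maximal v (k , sym x≡vᵏ)) v (1 , identityʳ v)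

  adj-from-e : ∀ {y} → y ≢ e → PowerAdj e y
  adj-from-e y≢e = ≢-sym y≢e , inj₂ (0 , refl)

  adj-to-e : ∀ {y} → y ≢ e → PowerAdj y e
  adj-to-e y≢e = y≢e , inj₁ (0 , refl)

  adj-to-inverse : ∀ {y} → y ∙ y ≢ e → PowerAdj y (y ⁻¹)
  adj-to-inverse {y} yy≢e with inverse-power y
  ... | k , yᵏ≡y⁻¹ = square≢e⇒≢inverse yy≢e , inj₁ (k , sym yᵏ≡y⁻¹)

  adj-from-inverse : ∀ {y} → y ∙ y ≢ e → PowerAdj (y ⁻¹) y
  adj-from-inverse {y} yy≢e with inverse-power y
  ... | k , yᵏ≡y⁻¹ = ≢-sym (square≢e⇒≢inverse yy≢e) , inj₂ (k , sym yᵏ≡y⁻¹)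

  adj-to-root : ∀ {x w} → x ≢ w → x ∈⟨ w ⟩ → PowerAdj x w
  adj-to-root x≢w (k , wᵏ≡x) = x≢w , inj₂ (k , sym wᵏ≡x)

  kind : Elt → Kind
  kind x with x ≟ e | (x ∙ x) ≟ e
  ... | yes _ | _ = identity
  ... | no _ | yes _ = involution
  ... | no _ | no _ = generic

  kind-e : kind e ≡ identity
  kind-e with e ≟ e
  ... | yes _ = refl
  ... | no e≢e = ⊥-elim (e≢e refl)

  kind-involution : ∀ {x} → Involution x → kind x ≡ involution
  kind-involution {x} (x≢e , xx≡e) with x ≟ e | (x ∙ x) ≟ e
  ... | yes x≡e | _ = ⊥-elim (x≢e x≡e)
  ... | no _ | yes _ = refl
  ... | no _ | no xx≢e = ⊥-elim (xx≢e xx≡e)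

  kind-generic : ∀ {x} → x ∙ x ≢ e → kind x ≡ generic
  kind-generic {x} xx≢e with x ≟ e | (x ∙ x) ≟ e
  ... | yes x≡e | _ = ⊥-elim (square≢e⇒≢e xx≢e x≡e)
  ... | no _ | yes xx≡e = ⊥-elim (xx≢e xx≡e)
  ... | no _ | no _ = refl

  kind-nonidentity : ∀ {y} → y ≢ e → kind y ≡ involution ⊎ kind y ≡ generic
  kind-nonidentity {y} y≢e = bySquare ((y ∙ y) ≟ e)
    where
      bySquare : Dec (y ∙ y ≡ e) → kind y ≡ involution ⊎ kind y ≡ generic
      bySquare (yes yy≡e) = inj₁ (kind-involution (y≢e , yy≡e))
      bySquare (no yy≢e) = inj₂ (kind-generic yy≢e)

  module Colouring (a b : Elt) (rooted : ∀ x → Involution x → x ≢ a → x ≢ b → Root x) where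

    involutionColour : Elt → Fin 3
    involutionColour x with x ≟ a | x ≟ b
    ... | yes _ | _ = c₀
    ... | no _ | yes _ = c₁
    ... | no _ | no _ = c₂

    precedence : ∀ {P : Set} → Dec P → Fin 3
    precedence (yes _) = c₀
    precedence (no _) = c₁

    pairColour : Elt → Fin 3
    pairColour x = precedence (toℕ x <? toℕ (x ⁻¹))

    -- The vertex colour (κ in the comments below).
    vertexColour : Elt → Fin 3
    vertexColour x with (x ∙ x) ≟ e
    ... | yes _ = involutionColour x
    ... | no _ = pairColour x

    vertexColour-involution : ∀ {x} → x ∙ x ≡ e → vertexColour x ≡ involutionColour x
    vertexColour-involution {x} xx≡e with (x ∙ x) ≟ e
    ... | yes _ = refl
    ... | no xx≢e = ⊥-elim (xx≢e xx≡e)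

    vertexColour-generic : ∀ {x} → x ∙ x ≢ e → vertexColour x ≡ pairColour x
    vertexColour-generic {x} xx≢e with (x ∙ x) ≟ e
    ... | yes xx≡e = ⊥-elim (xx≢e xx≡e)
    ... | no _ = refl

    sameInvolutionColour : ∀ {x y} → x ≢ y → involutionColour x ≡ involutionColour y →
                           x ≢ a × x ≢ b × involutionColour y ≡ c₂
    sameInvolutionColour {x} {y} x≢y same with x ≟ a | x ≟ b | y ≟ a | y ≟ b
    sameInvolutionColour x≢y _  | yes refl | _ | yes refl | _ = ⊥-elim (x≢y refl)
    sameInvolutionColour x≢y () | yes _ | _ | no _ | yes _
    sameInvolutionColour x≢y () | yes _ | _ | no _ | no _
    sameInvolutionColour x≢y () | no _ | yes _ | yes _ | _
    sameInvolutionColour x≢y _  | no _ | yes refl | no _ | yes refl = ⊥-elim (x≢y refl)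
    sameInvolutionColour x≢y () | no _ | yes _ | no _ | no _
    sameInvolutionColour x≢y () | no _ | no _ | yes _ | _
    sameInvolutionColour x≢y () | no _ | no _ | no _ | yes _
    sameInvolutionColour x≢y _  | no x≢a | no x≢b | no _ | no _ = x≢a , x≢b , refl

    pairColour≢c₂ : ∀ x → pairColour x ≢ c₂
    pairColour≢c₂ x with toℕ x <? toℕ (x ⁻¹)
    ... | yes _ = λ ()
    ... | no _ = λ ()

    pairColour-inverse : ∀ {x} → x ≢ x ⁻¹ → pairColour (x ⁻¹) ≡ opposite (pairColour x)
    pairColour-inverse {x} x≢x⁻¹ rewrite ⁻¹-involutive x
      with toℕ x <? toℕ (x ⁻¹) | toℕ (x ⁻¹) <? toℕ x
    ... | yes x<x⁻¹ | yes x⁻¹<x = ⊥-elim (<-asym x<x⁻¹ x⁻¹<x)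
    ... | yes _ | no _ = refl
    ... | no _ | yes _ = refl
    ... | no x≮x⁻¹ | no x⁻¹≮x =
      ⊥-elim (x≢x⁻¹ (toℕ-injective (≤-antisym (≮⇒≥ x⁻¹≮x) (≮⇒≥ x≮x⁻¹))))

    generic-colour≢c₂ : ∀ {x} → x ∙ x ≢ e → vertexColour x ≢ c₂
    generic-colour≢c₂ {x} xx≢e = ≢-resp (vertexColour-generic xx≢e) refl (pairColour≢c₂ x)

    generic-colour-inverse : ∀ {x} → x ∙ x ≢ e → vertexColour (x ⁻¹) ≡ opposite (vertexColour x)
    generic-colour-inverse {x} xx≢e = begin
      vertexColour (x ⁻¹)        ≡⟨ vertexColour-generic (inverse-square≢e xx≢e) ⟩
      pairColour (x ⁻¹)          ≡⟨ pairColour-inverse (square≢e⇒≢inverse xx≢e) ⟩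
      opposite (pairColour x)    ≡⟨ cong opposite (vertexColour-generic xx≢e) ⟨
      opposite (vertexColour x)  ∎
      where open ≡-Reasoning

    colour : Elt → Elt → Fin 3
    colour x y = edgeTable (kind x) (kind y) (vertexColour x) (vertexColour y)

    colouring : EdgeColouring PowerAdj 3
    colouring = record { col = colour ; symm = λ x y → edgeTable-symm (kind x) (kind y) _ _ }

    open RainbowPaths colouring

    colour-from-e : ∀ {y} → y ≢ e → colour e y ≡ vertexColour y
    colour-from-e {y} y≢e = byKind (kind-nonidentity y≢e)
      where
        byKind : kind y ≡ involution ⊎ kind y ≡ generic → colour e y ≡ vertexColour y
        byKind (inj₁ kind≡) rewrite kind-e | kind≡ = refl
        byKind (inj₂ kind≡) rewrite kind-e | kind≡ = refl

    colour-to-e : ∀ {y} → y ≢ e → colour y e ≡ vertexColour y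
    colour-to-e {y} y≢e = trans (edgeTable-symm (kind y) (kind e) _ _) (colour-from-e y≢e)

    colour-inverse-pair : ∀ {x} → x ∙ x ≢ e → colour x (x ⁻¹) ≡ c₂
    colour-inverse-pair xx≢e rewrite kind-generic xx≢e | kind-generic (inverse-square≢e xx≢e) = refl

    colour-pair-from-inverse : ∀ {x} → x ∙ x ≢ e → colour (x ⁻¹) x ≡ c₂
    colour-pair-from-inverse {x} xx≢e = trans (edgeTable-symm (kind (x ⁻¹)) (kind x) _ _) (colour-inverse-pair xx≢e)

    colour-root : ∀ {x w} → Involution x → w ∙ w ≢ e → colour x w ≡ opposite (vertexColour w)
    colour-root inv ww≢e rewrite kind-involution inv | kind-generic ww≢e = refl

    Joined : Elt → Elt → Set
    Joined x y = ∃[ vs ] RainbowPath PowerAdj colouring x y vs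

    viaIdentity : ∀ {x y} → x ≢ y → x ≢ e → y ≢ e → vertexColour x ≢ vertexColour y → Joined x y
    viaIdentity x≢y x≢e y≢e κx≢κy =
      _ , rainbowPath₂ (adj-to-e x≢e) (adj-from-e y≢e) x≢e x≢y (≢-sym y≢e)
            (≢-resp (colour-to-e x≢e) (colour-from-e y≢e) κx≢κy)

    -- Equal colours, y a non-involution: x–e–y⁻¹–y, coloured κ, opposite κ, c₂.
    viaInverseOfTarget : ∀ {x y} → x ≢ y → x ≢ e → y ∙ y ≢ e →
                         vertexColour x ≡ vertexColour y → Joined x y
    viaInverseOfTarget {x} {y} x≢y x≢e yy≢e κx≡κy =
      _ , rainbowPath₃ (adj-to-e x≢e) (adj-from-e y⁻¹≢e) (adj-from-inverse yy≢e)
            x≢e x≢y⁻¹ x≢y (≢-sym y⁻¹≢e) (≢-sym (square≢e⇒≢e yy≢e)) (≢-sym (square≢e⇒≢inverse yy≢e))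
            (≢-resp xe-colour ey⁻¹-colour (≢-sym (opposite-moves κy≢c₂)))
            (≢-resp xe-colour (colour-pair-from-inverse yy≢e) κy≢c₂)
            (≢-resp ey⁻¹-colour (colour-pair-from-inverse yy≢e) (opposite-avoids-c₂ κy≢c₂))
      where
        y⁻¹≢e : y ⁻¹ ≢ e
        y⁻¹≢e = square≢e⇒≢e (inverse-square≢e yy≢e)
        κy≢c₂ : vertexColour y ≢ c₂
        κy≢c₂ = generic-colour≢c₂ yy≢e
        xe-colour : colour x e ≡ vertexColour y
        xe-colour = trans (colour-to-e x≢e) κx≡κy
        ey⁻¹-colour : colour e (y ⁻¹) ≡ opposite (vertexColour y)
        ey⁻¹-colour = trans (colour-from-e y⁻¹≢e) (generic-colour-inverse yy≢e)
        x≢y⁻¹ : x ≢ y ⁻¹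
        x≢y⁻¹ x≡y⁻¹ = opposite-moves κy≢c₂
          (trans (sym (generic-colour-inverse yy≢e)) (trans (cong vertexColour (sym x≡y⁻¹)) κx≡κy))

    -- Equal colours, x a non-involution, y an involution:
    -- x–x⁻¹–e–y, coloured c₂, opposite κ, κ.
    viaInverseOfSource : ∀ {x y} → x ≢ y → y ≢ e → x ∙ x ≢ e → y ∙ y ≡ e →
                         vertexColour x ≡ vertexColour y → Joined x y
    viaInverseOfSource {x} {y} x≢y y≢e xx≢e yy≡e κx≡κy =
      _ , rainbowPath₃ (adj-to-inverse xx≢e) (adj-to-e x⁻¹≢e) (adj-from-e y≢e)
            (square≢e⇒≢inverse xx≢e) (square≢e⇒≢e xx≢e) x≢y x⁻¹≢e
            (≢-sym (square≡e⇒≢square≢e yy≡e (inverse-square≢e xx≢e))) (≢-sym y≢e)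
            (≢-resp (colour-inverse-pair xx≢e) x⁻¹e-colour (≢-sym (opposite-avoids-c₂ κx≢c₂)))
            (≢-resp (colour-inverse-pair xx≢e) ey-colour (≢-sym κx≢c₂))
            (≢-resp x⁻¹e-colour ey-colour (opposite-moves κx≢c₂))
      where
        x⁻¹≢e : x ⁻¹ ≢ e
        x⁻¹≢e = square≢e⇒≢e (inverse-square≢e xx≢e)
        κx≢c₂ : vertexColour x ≢ c₂
        κx≢c₂ = generic-colour≢c₂ xx≢e
        x⁻¹e-colour : colour (x ⁻¹) e ≡ opposite (vertexColour x)
        x⁻¹e-colour = trans (colour-to-e x⁻¹≢e) (generic-colour-inverse xx≢e)
        ey-colour : colour e y ≡ vertexColour x
        ey-colour = trans (colour-from-e y≢e) (sym κx≡κy)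

    -- Equal colours, both involutions: then x ∉ {a, b} has a root w and the
    -- path x–w–e–y is coloured opposite κ(w), κ(w), c₂.
    viaRoot : ∀ {x y} → x ≢ y → x ≢ e → y ≢ e → x ∙ x ≡ e → y ∙ y ≡ e →
              vertexColour x ≡ vertexColour y → Joined x y
    viaRoot {x} {y} x≢y x≢e y≢e xx≡e yy≡e κx≡κy
      with sameInvolutionColour x≢y
             (trans (sym (vertexColour-involution xx≡e)) (trans κx≡κy (vertexColour-involution yy≡e)))
    ... | x≢a , x≢b , colourY≡c₂ with rooted x (x≢e , xx≡e) x≢a x≢b
    ... | w , ww≢e , x∈⟨w⟩ =
      _ , rainbowPath₃ (adj-to-root x≢w x∈⟨w⟩) (adj-to-e w≢e) (adj-from-e y≢e)
            x≢w x≢e x≢y w≢e (≢-sym (square≡e⇒≢square≢e yy≡e ww≢e)) (≢-sym y≢e)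
            (≢-resp xw-colour (colour-to-e w≢e) (opposite-moves κw≢c₂))
            (≢-resp xw-colour ey-colour (opposite-avoids-c₂ κw≢c₂))
            (≢-resp (colour-to-e w≢e) ey-colour κw≢c₂)
      where
        x≢w : x ≢ w
        x≢w = square≡e⇒≢square≢e xx≡e ww≢e
        w≢e : w ≢ e
        w≢e = square≢e⇒≢e ww≢e
        κw≢c₂ : vertexColour w ≢ c₂
        κw≢c₂ = generic-colour≢c₂ ww≢e
        xw-colour : colour x w ≡ opposite (vertexColour w)
        xw-colour = colour-root (x≢e , xx≡e) ww≢e
        ey-colour : colour e y ≡ c₂
        ey-colour = trans (colour-from-e y≢e) (trans (vertexColour-involution yy≡e) colourY≡c₂)

    joinAwayFromIdentity : ∀ {x y} → x ≢ y → x ≢ e → y ≢ e → Joined x y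
    joinAwayFromIdentity {x} {y} x≢y x≢e y≢e =
      byCases (vertexColour x ≟ vertexColour y) ((x ∙ x) ≟ e) ((y ∙ y) ≟ e)
      where
        byCases : Dec (vertexColour x ≡ vertexColour y) → Dec (x ∙ x ≡ e) → Dec (y ∙ y ≡ e) → Joined x y
        byCases (no κx≢κy) _ _ = viaIdentity x≢y x≢e y≢e κx≢κy
        byCases (yes κx≡κy) _ (no yy≢e) = viaInverseOfTarget x≢y x≢e yy≢e κx≡κy
        byCases (yes κx≡κy) (no xx≢e) (yes yy≡e) = viaInverseOfSource x≢y y≢e xx≢e yy≡e κx≡κy
        byCases (yes κx≡κy) (yes xx≡e) (yes yy≡e) = viaRoot x≢y x≢e y≢e xx≡e yy≡e κx≡κy

    rainbow : IsRainbowColouring PowerAdj colouring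
    rainbow x y with x ≟ y | x ≟ e | y ≟ e
    ... | yes refl | _ | _ = [] , rainbowPath₀ x
    ... | no x≢y | yes refl | _ = _ , rainbowPath₁ (adj-from-e (≢-sym x≢y)) x≢y
    ... | no x≢y | no x≢e | yes refl = _ , rainbowPath₁ (adj-to-e x≢e) x≢y
    ... | no x≢y | no x≢e | no y≢e = joinAwayFromIdentity x≢y x≢e y≢e

  -- Two distinct maximal involutions a, b force at least three colours: they
  -- are pendant at e, and ab ∉ {a, b, e} is a fourth vertex.
  twoMaximal⇒3≤ : ∀ {a b k} {C : EdgeColouring PowerAdj k} → a ≢ b →
                  MaximalInvolution a → MaximalInvolution b → IsRainbowColouring PowerAdj C → 3 ≤ k
  twoMaximal⇒3≤ {a} {b} {C = C} a≢b maxA@((a≢e , aa≡e) , _) maxB@((b≢e , _) , _) =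
    RainbowPaths.twoPendants⇒3≤ C (maximal⇒pendant maxA) (maximal⇒pendant maxB)
      (≢-sym a≢b) b≢e ab≢a ab≢b ab≢e
    where
      ab≢a : a ∙ b ≢ a
      ab≢a ab≡a = b≢e (∙-cancelˡ a b e (trans ab≡a (sym (identityʳ a))))
      ab≢b : a ∙ b ≢ b
      ab≢b ab≡b = a≢e (∙-cancelʳ b a e (trans ab≡b (sym (identityˡ b))))
      ab≢e : a ∙ b ≢ e
      ab≢e ab≡e = a≢b (trans (square≡e⇒self-inverse aa≡e) (sym (inverseʳ-unique a b ab≡e)))

proposition2p7 : (G : FiniteGroup) →
    FiniteGroup.TwoMaximalInvolutions G →
    powerGraphRC G 3
proposition2p7 G (a , b , a≢b , maxA , maxB , onlyAB) =
  (colouring , rainbow) , λ j j<3 (C , rainbowC) → <⇒≱ j<3 (twoMaximal⇒3≤ {C = C} a≢b maxA maxB rainbowC)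
  where
    open FiniteGroup G using (Involution)
    open PowerGraph G

    rooted : ∀ x → Involution x → x ≢ a → x ≢ b → Root x
    rooted x inv x≢a x≢b =
      [ (λ maxX → ⊥-elim ([ x≢a , x≢b ] (onlyAB x maxX))) , id ] (maximal-or-rooted inv)

    open Colouring a b rooted
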